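{- (i) Any context with empty local part $G$ is compatible with any context $\Gamma$. (ii) Contexts $G_1,L_1$ and $G_2,L_2$ are compatible iff $L_1=L\,L_2$ or $L_2=L\,L_1$ for some list $L$ (juxtaposition denoting concatenation). (iii) If $\Gamma$ and $\Delta$ are compatible, their supremum $\Gamma\sqcup\Delta$ with respect to $\leqslant$ exists.
   Context: A context $\Gamma$ is a pair $G,L$ of a finite set $G$ of variables (global part) and a finite list $L$ of variables with repetitions allowed (local part); a context with empty local part is written $G$. The order $\leqslant$ on contexts is the least partial order such that $G,L<G\cup\{\mathsf{x}\},L$ whenever $\mathsf{x}\notin G$, and $G,L<(G\setminus\{\mathsf{x}\}),L'$ where $L'$ is the list $\mathsf{x}$ followed by $L$. Contexts $\Gamma$ and $\Delta$ are compatible iff there is a context $\Sigma$ with $\Gamma\leqslant\Sigma$ and $\Delta\leqslant\Sigma$. -}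

module Defs where

open import Data.List using (List; []; _∷_; _++_)
open import Data.List.Membership.Propositional using (_∈_; _∉_)
open import Data.Product using (Σ; _×_; _,_; ∃)
open import Data.Sum using (_⊎_)
open import Relation.Binary.PropositionalEquality using (_≡_; _≢_)
open import Relation.Binary.Construct.Closure.ReflexiveTransitive using (Star)
open import Function.Bundles using (_⇔_)

module Ctx (V : Set) where

  -- A context (G , L): G is a finite set of variables, represented by a
  -- list read up to its set of members; L is a list (repetitions allowed).
  record Context : Set where
    constructor _,,_
    field
      glob : List V
      loc  : List V
  open Context public

  globalOnly : List V → Context
  globalOnly G = G ,, []

  IsInsert : V → List V → List V → Set
  IsInsert x G G' = ∀ y → (y ∈ G' ⇔ (y ∈ G ⊎ y ≡ x))

  IsRemove : V → List V → List V → Set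
  IsRemove x G G' = ∀ y → (y ∈ G' ⇔ (y ∈ G × y ≢ x))

  _≈_ : Context → Context → Set
  Γ ≈ Δ = (∀ y → (y ∈ glob Γ ⇔ y ∈ glob Δ)) × (loc Γ ≡ loc Δ)

  data Step : Context → Context → Set where
    add  : ∀ {G G' L} x → x ∉ G → IsInsert x G G' → Step (G ,, L) (G' ,, L)
    move : ∀ {G G' L} x → IsRemove x G G' → Step (G ,, L) (G' ,, (x ∷ L))

  data Gen : Context → Context → Set where
    eqv  : ∀ {Γ Δ} → Γ ≈ Δ → Gen Γ Δ
    step : ∀ {Γ Δ} → Step Γ Δ → Gen Γ Δ

  _≤_ : Context → Context → Set
  _≤_ = Star Gen

  Compatible : Context → Context → Set
  Compatible Γ Δ = ∃ λ Σ' → Γ ≤ Σ' × Δ ≤ Σ'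

  IsSup : Context → Context → Context → Set
  IsSup Γ Δ Σ' = (Γ ≤ Σ' × Δ ≤ Σ') × (∀ Θ → Γ ≤ Θ → Δ ≤ Θ → Σ' ≤ Θ)

-- The heart of the proof is an explicit description of the order generated
-- by the steps (add a new global variable / move a global variable to the
-- front of the local part):
--
--   (G , L) ≤ (G' , L')  iff  L' = M ++ L for some list M with G ⊆ G' ++ M,
--
-- i.e. the local part only grows at the front, and every global variable
-- either stays global or has been moved into the new prefix M.  Soundness
-- (≤ implies this description) holds because the description is reflexive,
-- transitive and contains every generating step; completeness is shown by an
-- explicit chain: add all of G', move the variables of M one by one, and
-- finally enlarge the global part to G'.
--
-- With this in hand, two contexts are compatible exactly when their local
-- parts have a common extension at the front, i.e. one is a suffix of the
-- other (part ii); part (i) is the special case of an empty local part; and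
-- for L₁ = L ++ L₂ the supremum of (G₁ , L₁) and (G₂ , L₂) is
-- (G₁ ∪ (G₂ ∖ L) , L₁) (part iii).
module Submission where

open import Defs
open import Data.List using (List; _++_; []; _∷_; filter)
open import Data.List.Properties using (++-identityʳ; ++-assoc; ++-cancelʳ; ∷-injectiveʳ)
open import Data.List.Membership.Propositional using (_∈_; _∉_)
open import Data.List.Membership.Propositional.Properties
  using (∈-++⁺ˡ; ∈-++⁺ʳ; ∈-++⁻; ∈-filter⁺; ∈-filter⁻)
open import Data.List.Relation.Binary.Subset.Propositional using (_⊆_)
open import Data.List.Relation.Binary.Subset.Propositional.Properties
  using (⊆-trans; xs⊆xs++ys; ++⁺ˡ)
open import Data.List.Relation.Unary.Any using (here; there)
import Data.List.Membership.DecPropositional as DecMembership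
open import Data.Product using (_×_; ∃; _,_)
open import Data.Sum using (_⊎_; inj₁; inj₂)
open import Data.Empty using (⊥-elim)
open import Function.Bundles using (_⇔_; mk⇔; Equivalence)
open import Relation.Binary.Definitions using (DecidableEquality)
open import Relation.Binary.PropositionalEquality
  using (_≡_; refl; sym; trans; cong; subst)
open import Relation.Binary.Construct.Closure.ReflexiveTransitive
  using (ε; _◅_; _◅◅_)
open import Relation.Nullary using (yes; no; ¬?)

SuffixComparable : {A : Set} → List A → List A → Set
SuffixComparable L₁ L₂ = ∃ λ L → L₁ ≡ L ++ L₂ ⊎ L₂ ≡ L ++ L₁

common-prefix-extension : {A : Set} (M₁ L₁ M₂ L₂ : List A) →
  M₁ ++ L₁ ≡ M₂ ++ L₂ → SuffixComparable L₁ L₂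
common-prefix-extension []       L₁ M₂       L₂ e = M₂ , inj₁ e
common-prefix-extension (x ∷ M₁) L₁ []       L₂ e = x ∷ M₁ , inj₂ (sym e)
common-prefix-extension (x ∷ M₁) L₁ (y ∷ M₂) L₂ e =
  common-prefix-extension M₁ L₁ M₂ L₂ (∷-injectiveʳ e)

∈-++-∉ʳ : {A : Set} {x : A} (xs : List A) {ys : List A} →
  x ∈ xs ++ ys → x ∉ ys → x ∈ xs
∈-++-∉ʳ xs x∈ x∉ys with ∈-++⁻ xs x∈
... | inj₁ x∈xs = x∈xs
... | inj₂ x∈ys = ⊥-elim (x∉ys x∈ys)

module Contexts (V : Set) (_≟_ : DecidableEquality V) where
  open Ctx V
  open DecMembership _≟_ using (_∈?_)

  _⊑_ : Context → Context → Set
  (G ,, L) ⊑ (G' ,, L') = ∃ λ M → L' ≡ M ++ L × G ⊆ G' ++ M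

  ⊑-refl : ∀ Γ → Γ ⊑ Γ
  ⊑-refl (G ,, L) = [] , refl , xs⊆xs++ys G []

  ⊑-trans : ∀ {Γ Δ Θ} → Γ ⊑ Δ → Δ ⊑ Θ → Γ ⊑ Θ
  ⊑-trans {G ,, L} {G' ,, _} {G'' ,, _} (M , refl , G⊆) (N , refl , G'⊆) =
    N ++ M , sym (++-assoc N M L) ,
    ⊆-trans G⊆ (⊆-trans (++⁺ˡ M G'⊆) (λ {y} → subst (y ∈_) (++-assoc G'' N M)))

  gen⇒⊑ : ∀ {Γ Δ} → Gen Γ Δ → Γ ⊑ Δ
  gen⇒⊑ {G ,, _} {G' ,, _} (eqv (sameGlob , sameLoc)) =
    [] , sym sameLoc , λ {y} y∈G → ∈-++⁺ˡ (Equivalence.to (sameGlob y) y∈G)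
  gen⇒⊑ (step (add x _ isInsert)) =
    [] , refl , λ {y} y∈G → ∈-++⁺ˡ (Equivalence.from (isInsert y) (inj₁ y∈G))
  gen⇒⊑ {G ,, _} {G' ,, _} (step (move x isRemove)) = x ∷ [] , refl , kept
    where
    kept : G ⊆ G' ++ x ∷ []
    kept {y} y∈G with y ≟ x
    ... | yes y≡x = ∈-++⁺ʳ G' (here y≡x)
    ... | no  y≢x = ∈-++⁺ˡ (Equivalence.from (isRemove y) (y∈G , y≢x))

  sound : ∀ {Γ Δ} → Γ ≤ Δ → Γ ⊑ Δ
  sound {Γ} ε       = ⊑-refl Γ
  sound     (g ◅ s) = ⊑-trans (gen⇒⊑ g) (sound s)

  addOne : ∀ x G L → (G ,, L) ≤ ((x ∷ G) ,, L)
  addOne x G L with x ∈? G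
  ... | yes x∈G = eqv ((λ y → mk⇔ there (absorb y)) , refl) ◅ ε
    where
    absorb : ∀ y → y ∈ x ∷ G → y ∈ G
    absorb y (here refl) = x∈G
    absorb y (there y∈G) = y∈G
  ... | no  x∉G = step (add x x∉G λ y → mk⇔ (split y) (join y)) ◅ ε
    where
    split : ∀ y → y ∈ x ∷ G → y ∈ G ⊎ y ≡ x
    split y (here y≡x)  = inj₂ y≡x
    split y (there y∈G) = inj₁ y∈G
    join : ∀ y → y ∈ G ⊎ y ≡ x → y ∈ x ∷ G
    join y (inj₁ y∈G) = there y∈G
    join y (inj₂ y≡x) = here y≡x

  addAll : ∀ A G L → (G ,, L) ≤ ((A ++ G) ,, L)
  addAll []      G L = ε
  addAll (x ∷ A) G L = addAll A G L ◅◅ addOne x (A ++ G) L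

  grow : ∀ {G H} L → G ⊆ H → (G ,, L) ≤ (H ,, L)
  grow {G} {H} L G⊆H = addAll H G L ◅◅ (eqv ((λ y → mk⇔ collapse ∈-++⁺ˡ) , refl) ◅ ε)
    where
    collapse : H ++ G ⊆ H
    collapse y∈ with ∈-++⁻ H y∈
    ... | inj₁ y∈H = y∈H
    ... | inj₂ y∈G = G⊆H y∈G

  remove : V → List V → List V
  remove x = filter (λ y → ¬? (y ≟ x))

  strip : List V → List V → List V
  strip []      G = G
  strip (x ∷ M) G = remove x (strip M G)

  strip⁻ : ∀ M G {y} → y ∈ strip M G → y ∈ G × y ∉ M
  strip⁻ []      G y∈ = y∈ , λ ()
  strip⁻ (x ∷ M) G y∈ with ∈-filter⁻ (λ z → ¬? (z ≟ x)) {xs = strip M G} y∈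
  ... | y∈strip , y≢x with strip⁻ M G y∈strip
  ... | y∈G , y∉M = y∈G , λ { (here y≡x) → y≢x y≡x ; (there y∈M) → y∉M y∈M }

  moveAll : ∀ M G L → (G ,, L) ≤ (strip M G ,, (M ++ L))
  moveAll []      G L = ε
  moveAll (x ∷ M) G L = moveAll M G L ◅◅ (step (move x removeIs) ◅ ε)
    where
    removeIs : IsRemove x (strip M G) (remove x (strip M G))
    removeIs y = mk⇔ (∈-filter⁻ (λ z → ¬? (z ≟ x)))
                     (λ (y∈ , y≢x) → ∈-filter⁺ (λ z → ¬? (z ≟ x)) y∈ y≢x)

  complete : ∀ {Γ Δ} → Γ ⊑ Δ → Γ ≤ Δ
  complete {G ,, L} {G' ,, _} (M , refl , G⊆) =
    addAll G' G L ◅◅ (moveAll M (G' ++ G) L ◅◅ grow (M ++ L) stripped⊆G')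
    where
    -- what survives stripping M is in G', since G ⊆ G' ++ M
    stripped⊆G' : strip M (G' ++ G) ⊆ G'
    stripped⊆G' y∈ with strip⁻ M (G' ++ G) y∈
    ... | y∈G'++G , y∉M with ∈-++⁻ G' y∈G'++G
    ... | inj₁ y∈G' = y∈G'
    ... | inj₂ y∈G  = ∈-++-∉ʳ G' (G⊆ y∈G) y∉M

  compatible⇔suffixComparable : ∀ G₁ L₁ G₂ L₂ →
    Compatible (G₁ ,, L₁) (G₂ ,, L₂) ⇔ SuffixComparable L₁ L₂
  compatible⇔suffixComparable G₁ L₁ G₂ L₂ = mk⇔ to from
    where
    to : Compatible (G₁ ,, L₁) (G₂ ,, L₂) → SuffixComparable L₁ L₂
    to (_ , s₁ , s₂) with sound s₁ | sound s₂
    ... | M₁ , e₁ , _ | M₂ , e₂ , _ = common-prefix-extension M₁ L₁ M₂ L₂ (trans (sym e₁) e₂)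
    from : SuffixComparable L₁ L₂ → Compatible (G₁ ,, L₁) (G₂ ,, L₂)
    from (L , inj₁ e) = (G₁ ++ G₂) ,, L₁ ,
      complete ([] , refl , λ y∈ → ∈-++⁺ˡ (∈-++⁺ˡ y∈)) ,
      complete (L , e , λ y∈ → ∈-++⁺ˡ (∈-++⁺ʳ G₁ y∈))
    from (L , inj₂ e) = (G₁ ++ G₂) ,, L₂ ,
      complete (L , e , λ y∈ → ∈-++⁺ˡ (∈-++⁺ˡ y∈)) ,
      complete ([] , refl , λ y∈ → ∈-++⁺ˡ (∈-++⁺ʳ G₁ y∈))

  -- Part (i): an empty local part is a suffix of every local part.
  globalOnly-compatible : ∀ G Γ → Compatible (globalOnly G) Γ
  globalOnly-compatible G (G₂ ,, L₂) =
    Equivalence.from (compatible⇔suffixComparable G [] G₂ L₂)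
      (L₂ , inj₂ (sym (++-identityʳ L₂)))

  _∖_ : List V → List V → List V
  G ∖ L = filter (λ y → ¬? (y ∈? L)) G

  ∖⁺ : ∀ {y} G L → y ∈ G → y ∉ L → y ∈ G ∖ L
  ∖⁺ G L = ∈-filter⁺ (λ z → ¬? (z ∈? L))

  ∖⁻ : ∀ {y} G L → y ∈ G ∖ L → y ∈ G × y ∉ L
  ∖⁻ G L = ∈-filter⁻ (λ z → ¬? (z ∈? L)) {xs = G}

  IsSup-sym : ∀ {Γ Δ S} → IsSup Γ Δ S → IsSup Δ Γ S
  IsSup-sym ((Γ≤S , Δ≤S) , least) = (Δ≤S , Γ≤S) , λ Θ Δ≤Θ Γ≤Θ → least Θ Γ≤Θ Δ≤Θ

  -- The supremum of (G₁ , L ++ L₂) and (G₂ , L₂): the variables of G₂ that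
  -- occur in L must be moved, the others stay global.
  supOfExtension : ∀ G₁ G₂ L L₂ →
    IsSup (G₁ ,, (L ++ L₂)) (G₂ ,, L₂) ((G₁ ++ (G₂ ∖ L)) ,, (L ++ L₂))
  supOfExtension G₁ G₂ L L₂ = (upper₁ , upper₂) , least
    where
    K : List V
    K = G₂ ∖ L
    upper₁ : (G₁ ,, (L ++ L₂)) ≤ ((G₁ ++ K) ,, (L ++ L₂))
    upper₁ = complete ([] , refl , λ y∈ → ∈-++⁺ˡ (∈-++⁺ˡ y∈))
    upper₂ : (G₂ ,, L₂) ≤ ((G₁ ++ K) ,, (L ++ L₂))
    upper₂ = complete (L , refl , kept)
      where
      kept : G₂ ⊆ (G₁ ++ K) ++ L
      kept {y} y∈G₂ with y ∈? L
      ... | yes y∈L = ∈-++⁺ʳ (G₁ ++ K) y∈L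
      ... | no  y∉L = ∈-++⁺ˡ (∈-++⁺ʳ G₁ (∖⁺ G₂ L y∈G₂ y∉L))
    least : ∀ Θ → (G₁ ,, (L ++ L₂)) ≤ Θ → (G₂ ,, L₂) ≤ Θ → ((G₁ ++ K) ,, (L ++ L₂)) ≤ Θ
    least (G' ,, L') t₁ t₂ with sound t₁ | sound t₂
    ... | M₁ , refl , G₁⊆ | M₂ , e₂ , G₂⊆ = complete (M₁ , refl , bounded)
      where
      M₂≡M₁++L : M₂ ≡ M₁ ++ L
      M₂≡M₁++L = ++-cancelʳ L₂ M₂ (M₁ ++ L) (trans (sym e₂) (sym (++-assoc M₁ L L₂)))
      bounded : G₁ ++ K ⊆ G' ++ M₁
      bounded {y} y∈ with ∈-++⁻ G₁ y∈
      ... | inj₁ y∈G₁ = G₁⊆ y∈G₁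
      ... | inj₂ y∈K with ∖⁻ G₂ L y∈K
      ... | y∈G₂ , y∉L = ∈-++-∉ʳ (G' ++ M₁)
            (subst (y ∈_) (trans (cong (G' ++_) M₂≡M₁++L) (sym (++-assoc G' M₁ L))) (G₂⊆ y∈G₂))
            y∉L

  supremum : ∀ Γ Δ → Compatible Γ Δ → ∃ λ S → IsSup Γ Δ S
  supremum (G₁ ,, L₁) (G₂ ,, L₂) c
    with Equivalence.to (compatible⇔suffixComparable G₁ L₁ G₂ L₂) c
  ... | L , inj₁ refl = _ , supOfExtension G₁ G₂ L L₂
  ... | L , inj₂ refl = _ , IsSup-sym (supOfExtension G₂ G₁ L L₁)

mainTheorem12 : (V : Set) → DecidableEquality V →
    ((G : List V) (Γ : Ctx.Context V) → Ctx.Compatible V (Ctx.globalOnly V G) Γ)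
    × ((G₁ L₁ G₂ L₂ : List V) →
        (Ctx.Compatible V (G₁ Ctx.,, L₁) (G₂ Ctx.,, L₂)
          ⇔ (∃ λ L → L₁ ≡ L ++ L₂ ⊎ L₂ ≡ L ++ L₁)))
    × ((Γ Δ : Ctx.Context V) → Ctx.Compatible V Γ Δ →
        ∃ λ S → Ctx.IsSup V Γ Δ S)
mainTheorem12 V _≟_ =
  globalOnly-compatible , compatible⇔suffixComparable , supremum
  where open Contexts V _≟_
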